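{- Let $G$ be a graph, $t$ a positive integer, and let $U\subseteq V(G)$ induce an inclusion-maximal $t$-secluded clique in $G$. Then there exists a set $\tilde{U}\subseteq V(\tilde{G})$ such that (1) $U$ is the expansion of $\tilde{U}$; (2) $\tilde{U}$ induces a $t$-secluded clique in $\tilde{G}$; and (3) $|\tilde{U}|\le 2^t$.
   Context: All graphs are finite, simple, undirected. For $U\subseteq V(G)$, $N_G(U)=\left(\bigcup_{v\in U}N_G(v)\right)\setminus U$; $U$ (or $G[U]$) is $t$-secluded if $|N_G(U)|\le t$. Vertices $u,v$ are true twins if $N_G[u]=N_G[v]$ ($N_G[v]=N_G(v)\cup\{v\}$). Let $\mathcal{L}$ be the family of all inclusion-maximal sets of pairwise true twins of $G$; it partitions $V(G)$. The graph $\tilde{G}$ has one node $x_L$ for each $L\in\mathcal{L}$, and $x_{L_1}x_{L_2}$ is an edge of $\tilde{G}$ (for $L_1\ne L_2$) iff $G$ has an edge with one endpoint in $L_1$ and the other in $L_2$. A set $U\subseteq V(G)$ is the expansion of $\tilde{U}\subseteq V(\tilde{G})$ if $U=\bigcup_{x_L\in\tilde{U}}L$. -}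

module Defs where

open import Data.Nat using (ℕ; zero; suc; _≤_)
open import Data.Fin using (Fin; zero; suc; _≟_)
open import Data.Fin.Subset using (Subset; _∈_; _⊆_; ∣_∣)
open import Data.Vec using (Vec; lookup; tabulate)
open import Data.Bool using (Bool; true; false; _∧_; _∨_; not)
open import Data.Product using (Σ; _×_; ∃)
open import Relation.Nullary.Decidable using (⌊_⌋)
open import Relation.Binary.PropositionalEquality using (_≡_; _≢_)
open import Function.Bundles using (_⇔_)

anyFin : {n : ℕ} → (Fin n → Bool) → Bool
anyFin {zero}  f = false
anyFin {suc n} f = f zero ∨ anyFin (λ i → f (suc i))

record Graph : Set where
  field
    n      : ℕ
    adj    : Fin n → Fin n → Bool
    sym    : ∀ u v → adj u v ≡ adj v u
    irrefl : ∀ v → adj v v ≡ false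

-- Notions below are stated for an arbitrary adjacency relation on Fin n
-- (so they apply both to G and to the twin-quotient graph G̃).

nbhd : {n : ℕ} → (Fin n → Fin n → Bool) → Subset n → Subset n
nbhd adj U = tabulate (λ v → not (lookup U v) ∧ anyFin (λ u → lookup U u ∧ adj u v))

Secluded : {n : ℕ} → (Fin n → Fin n → Bool) → ℕ → Subset n → Set
Secluded adj t U = ∣ nbhd adj U ∣ ≤ t

IsClique : {n : ℕ} → (Fin n → Fin n → Bool) → Subset n → Set
IsClique adj U = ∀ u v → u ∈ U → v ∈ U → u ≢ v → adj u v ≡ true

IsMaxSecludedClique : {n : ℕ} → (Fin n → Fin n → Bool) → ℕ → Subset n → Set
IsMaxSecludedClique adj t U =
  IsClique adj U × Secluded adj t U ×
  (∀ W → U ⊆ W → IsClique adj W → Secluded adj t W → W ⊆ U)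

closedNbhd : (G : Graph) → Fin (Graph.n G) → Subset (Graph.n G)
closedNbhd G v = tabulate (λ u → ⌊ u ≟ v ⌋ ∨ Graph.adj G v u)

TrueTwins : (G : Graph) → Fin (Graph.n G) → Fin (Graph.n G) → Set
TrueTwins G u v = closedNbhd G u ≡ closedNbhd G v

-- The family of maximal true-twin classes, presented as a surjection
-- q : V(G) → Fin m whose fibres are exactly the true-twin classes.
-- Node x : Fin m of G̃ corresponds to the class L = q⁻¹(x).
record TwinQuotient (G : Graph) : Set where
  field
    m      : ℕ
    q      : Fin (Graph.n G) → Fin m
    surj   : ∀ x → ∃ (λ v → q v ≡ x)
    twins  : ∀ u v → (q u ≡ q v) ⇔ TrueTwins G u v

quotAdj : (G : Graph) → (Q : TwinQuotient G) →
          Fin (TwinQuotient.m Q) → Fin (TwinQuotient.m Q) → Bool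
quotAdj G Q x y =
  not ⌊ x ≟ y ⌋ ∧
  anyFin (λ u → anyFin (λ v →
    ⌊ TwinQuotient.q Q u ≟ x ⌋ ∧ ⌊ TwinQuotient.q Q v ≟ y ⌋ ∧ Graph.adj G u v))

IsExpansion : (G : Graph) → (Q : TwinQuotient G) →
              Subset (Graph.n G) → Subset (TwinQuotient.m Q) → Set
IsExpansion G Q U Ũ = ∀ v → (v ∈ U) ⇔ (TwinQuotient.q Q v ∈ Ũ)

-- Maximality makes U closed under true twins: adding a twin a of a member b keeps U a clique
-- and does not enlarge N(U), because N(a) ∖ {b} = N(b) ∖ {a}. Hence U is the expansion of the set
-- Ũ of classes meeting U, which is a clique of G̃, and choosing a representative of each class
-- maps N(Ũ) injectively into N(U). Finally, no vertex outside U ∪ N(U) sees U, so two members of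
-- the clique U whose neighbourhoods agree on N(U) are true twins; thus x ↦ N(rep x) ∩ N(U) is
-- injective on Ũ and |Ũ| ≤ 2^|N(U)| ≤ 2^t.
module Submission where

open import Data.Bool using (Bool; true; false; _∧_; _∨_; not)
open import Data.Bool.Properties using (∧-conicalˡ; ∧-conicalʳ; ∧-identityʳ; ∨-zeroʳ; ¬-not)
open import Data.Nat using (ℕ; zero; suc; _≤_; _^_; _+_; s≤s; z≤n)
open import Data.Nat.Properties using (≤-trans; ^-monoʳ-≤)
open import Data.Fin using (Fin; zero; suc; _↑ˡ_; _↑ʳ_; splitAt; _≟_)
open import Data.Fin.Properties using (suc-injective; 0≢1+n; ↑ˡ-injective; ↑ʳ-injective; splitAt-↑ˡ; splitAt-↑ʳ)
open import Data.Fin.Subset using (Subset; _∈_; _∉_; _⊆_; ∣_∣; _∪_; _∩_; ⁅_⁆; _-_; inside; outside)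
open import Data.Fin.Subset.Properties
  using (∣⊤∣≡n; ∈⊤; x∈p∧x≢y⇒x∈p-y; x∈p⇒∣p-x∣<∣p∣; drop-∷-⊆; _∈?_; p⊆p∪q; x∈p∪q⁺; x∈p∪q⁻;
         x∈⁅x⁆; x∈⁅y⁆⇒x≡y; p⊆q⇒∣p∣≤∣q∣; p∩q⊆q)
open import Data.Vec using ([]; _∷_; here; there; lookup; tabulate)
open import Data.Vec.Properties using (lookup∘tabulate; tabulate-cong; lookup-zipWith; []=⇒lookup; lookup⇒[]=)
open import Data.Sum using (_⊎_; inj₁; inj₂)
open import Data.Product using (Σ; ∃; ∃₂; _×_; _,_; proj₁; proj₂)
open import Function using (_∘_; flip)
open import Function.Bundles using (Equivalence; mk⇔)
open import Relation.Binary.PropositionalEquality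
open import Relation.Nullary using (yes; no; contradiction)
open import Relation.Nullary.Decidable using (⌊_⌋; isYes≗does; dec-true; dec-false)

open import Defs

private
  variable
    k m n : ℕ

injectiveOn⇒∣p∣≤∣q∣ : {p : Subset m} {q : Subset n} (f : Fin m → Fin n) →
  (∀ {x} → x ∈ p → f x ∈ q) → (∀ {x y} → x ∈ p → y ∈ p → f x ≡ f y → x ≡ y) →
  ∣ p ∣ ≤ ∣ q ∣
injectiveOn⇒∣p∣≤∣q∣ {p = []} f maps inj = z≤n
injectiveOn⇒∣p∣≤∣q∣ {p = outside ∷ p} f maps inj =
  injectiveOn⇒∣p∣≤∣q∣ (f ∘ suc) (maps ∘ there) (λ x∈p y∈p → suc-injective ∘ inj (there x∈p) (there y∈p))
injectiveOn⇒∣p∣≤∣q∣ {p = inside ∷ p} {q} f maps inj =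
  ≤-trans (s≤s (injectiveOn⇒∣p∣≤∣q∣ (f ∘ suc) mapsRest injRest)) (x∈p⇒∣p-x∣<∣p∣ (maps here))
  where
  mapsRest : ∀ {x} → x ∈ p → f (suc x) ∈ q - f zero
  mapsRest x∈p = x∈p∧x≢y⇒x∈p-y (maps (there x∈p)) (0≢1+n ∘ inj here (there x∈p) ∘ sym)
  injRest : ∀ {x y} → x ∈ p → y ∈ p → f (suc x) ≡ f (suc y) → x ≡ y
  injRest x∈p y∈p = suc-injective ∘ inj (there x∈p) (there y∈p)

↑ˡ≢↑ʳ : ∀ {m n} (i : Fin m) (j : Fin n) → i ↑ˡ n ≢ m ↑ʳ j
↑ˡ≢↑ʳ {m} {n} i j eq with () ← trans (sym (splitAt-↑ˡ m i n)) (trans (cong (splitAt m) eq) (splitAt-↑ʳ m n j))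

subsetIndex : (s : Subset k) → Subset k → Fin (2 ^ ∣ s ∣)
subsetIndex []            []            = zero
subsetIndex (outside ∷ s) (_ ∷ t)       = subsetIndex s t
subsetIndex (inside ∷ s)  (outside ∷ t) = subsetIndex s t ↑ˡ (2 ^ ∣ s ∣ + 0)
subsetIndex (inside ∷ s)  (inside ∷ t)  = 2 ^ ∣ s ∣ ↑ʳ (subsetIndex s t ↑ˡ 0)

subsetIndex-injective : {s t u : Subset k} → t ⊆ s → u ⊆ s → subsetIndex s t ≡ subsetIndex s u → t ≡ u
subsetIndex-injective {s = []} {[]} {[]} _ _ _ = refl
subsetIndex-injective {s = outside ∷ s} {inside ∷ t} t⊆s _ _ with () ← t⊆s here
subsetIndex-injective {s = outside ∷ s} {_} {inside ∷ u} _ u⊆s _ with () ← u⊆s here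
subsetIndex-injective {s = outside ∷ s} {outside ∷ t} {outside ∷ u} t⊆s u⊆s eq =
  cong (outside ∷_) (subsetIndex-injective (drop-∷-⊆ t⊆s) (drop-∷-⊆ u⊆s) eq)
subsetIndex-injective {s = inside ∷ s} {outside ∷ t} {outside ∷ u} t⊆s u⊆s eq =
  cong (outside ∷_) (subsetIndex-injective (drop-∷-⊆ t⊆s) (drop-∷-⊆ u⊆s) (↑ˡ-injective _ _ _ eq))
subsetIndex-injective {s = inside ∷ s} {inside ∷ t} {inside ∷ u} t⊆s u⊆s eq =
  cong (inside ∷_) (subsetIndex-injective (drop-∷-⊆ t⊆s) (drop-∷-⊆ u⊆s)
    (↑ˡ-injective 0 _ _ (↑ʳ-injective (2 ^ ∣ s ∣) _ _ eq)))
subsetIndex-injective {s = inside ∷ s} {outside ∷ t} {inside ∷ u} _ _ eq = contradiction eq (↑ˡ≢↑ʳ _ _)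
subsetIndex-injective {s = inside ∷ s} {inside ∷ t} {outside ∷ u} _ _ eq = contradiction (sym eq) (↑ˡ≢↑ʳ _ _)

injectiveOn⇒∣p∣≤2^∣s∣ : {p : Subset m} {s : Subset k} (f : Fin m → Subset k) →
  (∀ {x} → x ∈ p → f x ⊆ s) → (∀ {x y} → x ∈ p → y ∈ p → f x ≡ f y → x ≡ y) →
  ∣ p ∣ ≤ 2 ^ ∣ s ∣
injectiveOn⇒∣p∣≤2^∣s∣ {s = s} f f⊆s inj =
  subst (_ ≤_) (∣⊤∣≡n (2 ^ ∣ s ∣))
    (injectiveOn⇒∣p∣≤∣q∣ (subsetIndex s ∘ f) (λ _ → ∈⊤)
      (λ x∈p y∈p → inj x∈p y∈p ∘ subsetIndex-injective (f⊆s x∈p) (f⊆s y∈p)))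

∈-tabulate⁺ : {f : Fin n → Bool} {x : Fin n} → f x ≡ true → x ∈ tabulate f
∈-tabulate⁺ {f = f} {x} fx = lookup⇒[]= x (tabulate f) (trans (lookup∘tabulate f x) fx)

∈-tabulate⁻ : {f : Fin n → Bool} {x : Fin n} → x ∈ tabulate f → f x ≡ true
∈-tabulate⁻ {f = f} {x} x∈ = trans (sym (lookup∘tabulate f x)) ([]=⇒lookup x∈)

∉⇒lookup≡false : {p : Subset n} {x : Fin n} → x ∉ p → lookup p x ≡ false
∉⇒lookup≡false {p = p} {x} x∉p = ¬-not (x∉p ∘ lookup⇒[]= x p)

∈∧∉⇒≢ : {p : Subset n} {x y : Fin n} → x ∈ p → y ∉ p → x ≢ y
∈∧∉⇒≢ x∈p y∉p refl = y∉p x∈p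

⌊≟⌋≡true⁺ : {x y : Fin n} → x ≡ y → ⌊ x ≟ y ⌋ ≡ true
⌊≟⌋≡true⁺ {x = x} {y} x≡y = trans (isYes≗does (x ≟ y)) (dec-true (x ≟ y) x≡y)

⌊≟⌋≡true⁻ : {x y : Fin n} → ⌊ x ≟ y ⌋ ≡ true → x ≡ y
⌊≟⌋≡true⁻ {x = x} {y} eq with x ≟ y
... | yes x≡y = x≡y

⌊≟⌋≡false : {x y : Fin n} → x ≢ y → ⌊ x ≟ y ⌋ ≡ false
⌊≟⌋≡false {x = x} {y} x≢y = trans (isYes≗does (x ≟ y)) (dec-false (x ≟ y) x≢y)

anyFin-true⁺ : (f : Fin n → Bool) (i : Fin n) → f i ≡ true → anyFin f ≡ true
anyFin-true⁺ f zero    fi = cong (_∨ anyFin (f ∘ suc)) fi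
anyFin-true⁺ f (suc i) fi = trans (cong (f zero ∨_) (anyFin-true⁺ (f ∘ suc) i fi)) (∨-zeroʳ (f zero))

anyFin-true⁻ : (f : Fin n → Bool) → anyFin f ≡ true → ∃ λ i → f i ≡ true
anyFin-true⁻ {suc n} f any with f zero in f0
... | true  = zero , f0
... | false with i , fi ← anyFin-true⁻ (f ∘ suc) any = suc i , fi

module _ {adj : Fin n → Fin n → Bool} {U : Subset n} where

  ∈-nbhd⁺ : {u v : Fin n} → v ∉ U → u ∈ U → adj u v ≡ true → v ∈ nbhd adj U
  ∈-nbhd⁺ {u} v∉U u∈U uv = ∈-tabulate⁺ (cong₂ _∧_ (cong not (∉⇒lookup≡false v∉U))
    (anyFin-true⁺ _ u (cong₂ _∧_ ([]=⇒lookup u∈U) uv)))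

  ∈-nbhd⁻ : {v : Fin n} → v ∈ nbhd adj U → v ∉ U × ∃ λ u → u ∈ U × adj u v ≡ true
  ∈-nbhd⁻ {v} v∈N = v∉U , u , lookup⇒[]= u U (∧-conicalˡ _ _ Uu∧uv) , ∧-conicalʳ _ _ Uu∧uv
    where
    notU∧any : not (lookup U v) ∧ anyFin (λ u → lookup U u ∧ adj u v) ≡ true
    notU∧any = ∈-tabulate⁻ v∈N
    v∉U : v ∉ U
    v∉U v∈U with () ← trans (sym (∧-conicalˡ _ _ notU∧any)) (cong not ([]=⇒lookup v∈U))
    witness : ∃ λ u → lookup U u ∧ adj u v ≡ true
    witness = anyFin-true⁻ _ (∧-conicalʳ _ _ notU∧any)
    u = proj₁ witness
    Uu∧uv = proj₂ witness

module _ (G : Graph) where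
  open Graph G using (adj)
  private
    V = Fin (Graph.n G)

  lookup-closedNbhd-≢ : {v w : V} → w ≢ v → lookup (closedNbhd G v) w ≡ adj v w
  lookup-closedNbhd-≢ {v} {w} w≢v =
    trans (lookup∘tabulate _ w) (cong (_∨ adj v w) (⌊≟⌋≡false w≢v))

  twins-adj : {a b w : V} → TrueTwins G a b → w ≢ a → w ≢ b → adj a w ≡ adj b w
  twins-adj {a} {b} {w} twins w≢a w≢b = begin
    adj a w                    ≡⟨ lookup-closedNbhd-≢ w≢a ⟨
    lookup (closedNbhd G a) w  ≡⟨ cong (flip lookup w) twins ⟩
    lookup (closedNbhd G b) w  ≡⟨ lookup-closedNbhd-≢ w≢b ⟩
    adj b w                    ∎
    where open ≡-Reasoning

  twins-adjacent : {a b : V} → TrueTwins G a b → a ≢ b → adj a b ≡ true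
  twins-adjacent {a} {b} twins a≢b = begin
    adj a b                    ≡⟨ lookup-closedNbhd-≢ (a≢b ∘ sym) ⟨
    lookup (closedNbhd G a) b  ≡⟨ cong (flip lookup b) twins ⟩
    lookup (closedNbhd G b) b  ≡⟨ lookup∘tabulate _ b ⟩
    ⌊ b ≟ b ⌋ ∨ adj b b        ≡⟨ cong (_∨ adj b b) (⌊≟⌋≡true⁺ refl) ⟩
    true                       ∎
    where open ≡-Reasoning

  trueTwins-intro : {a b : V} → (a ≢ b → adj a b ≡ true) →
    (∀ w → w ≢ a → w ≢ b → adj a w ≡ adj b w) → TrueTwins G a b
  trueTwins-intro {a} {b} adjacent sameAdj = tabulate-cong pointwise
    where
    pointwise : ∀ w → (⌊ w ≟ a ⌋ ∨ adj a w) ≡ (⌊ w ≟ b ⌋ ∨ adj b w)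
    pointwise w with w ≟ a | w ≟ b
    ... | yes refl | yes refl = refl
    ... | yes refl | no w≢b   = sym (trans (Graph.sym G b a) (adjacent w≢b))
    ... | no w≢a   | yes refl = adjacent (w≢a ∘ sym)
    ... | no w≢a   | no w≢b   = sameAdj w w≢a w≢b

  TwinClosed : Subset (Graph.n G) → Set
  TwinClosed U = ∀ {a b} → TrueTwins G a b → b ∈ U → a ∈ U

  module _ {U : Subset (Graph.n G)} {a b : V} (twins : TrueTwins G a b) (b∈U : b ∈ U) where

    twin-adjacent-to-clique : IsClique adj U → ∀ {v} → v ∈ U → a ≢ v → adj a v ≡ true
    twin-adjacent-to-clique isClique {v} v∈U a≢v with v ≟ b
    ... | yes refl = twins-adjacent twins a≢v
    ... | no v≢b   = trans (twins-adj twins (a≢v ∘ sym) v≢b) (isClique b v b∈U v∈U (v≢b ∘ sym))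

    ∪-twin-isClique : IsClique adj U → IsClique adj (U ∪ ⁅ a ⁆)
    ∪-twin-isClique isClique u v u∈W v∈W u≢v with x∈p∪q⁻ U ⁅ a ⁆ u∈W | x∈p∪q⁻ U ⁅ a ⁆ v∈W
    ... | inj₁ u∈U | inj₁ v∈U = isClique u v u∈U v∈U u≢v
    ... | inj₂ u∈a | inj₁ v∈U with refl ← x∈⁅y⁆⇒x≡y a u∈a = twin-adjacent-to-clique isClique v∈U u≢v
    ... | inj₁ u∈U | inj₂ v∈a with refl ← x∈⁅y⁆⇒x≡y a v∈a =
      trans (Graph.sym G u a) (twin-adjacent-to-clique isClique u∈U (u≢v ∘ sym))
    ... | inj₂ u∈a | inj₂ v∈a = contradiction (trans (x∈⁅y⁆⇒x≡y a u∈a) (sym (x∈⁅y⁆⇒x≡y a v∈a))) u≢v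

    ∪-twin-nbhd⊆ : nbhd adj (U ∪ ⁅ a ⁆) ⊆ nbhd adj U
    ∪-twin-nbhd⊆ {w} w∈N with w∉W , z , z∈W , zw ← ∈-nbhd⁻ w∈N = via (x∈p∪q⁻ U ⁅ a ⁆ z∈W) zw
      where
      w∉U : w ∉ U
      w∉U = w∉W ∘ p⊆p∪q ⁅ a ⁆
      w≢a : w ≢ a
      w≢a refl = w∉W (x∈p∪q⁺ (inj₂ (x∈⁅x⁆ a)))
      via : ∀ {z} → z ∈ U ⊎ z ∈ ⁅ a ⁆ → adj z w ≡ true → w ∈ nbhd adj U
      via (inj₁ z∈U) zw = ∈-nbhd⁺ w∉U z∈U zw
      via (inj₂ z∈a) zw with refl ← x∈⁅y⁆⇒x≡y a z∈a =
        ∈-nbhd⁺ w∉U b∈U (trans (sym (twins-adj twins w≢a (∈∧∉⇒≢ b∈U w∉U ∘ sym))) zw)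

  maxSecludedClique-twinClosed : ∀ {t U} → IsMaxSecludedClique adj t U → TwinClosed U
  maxSecludedClique-twinClosed {U = U} (isClique , secluded , maximal) {a} twins b∈U =
    maximal (U ∪ ⁅ a ⁆) (p⊆p∪q ⁅ a ⁆) (∪-twin-isClique twins b∈U isClique)
      (≤-trans (p⊆q⇒∣p∣≤∣q∣ (∪-twin-nbhd⊆ twins b∈U)) secluded) (x∈p∪q⁺ (inj₂ (x∈⁅x⁆ a)))

  neighbours : V → Subset (Graph.n G)
  neighbours v = tabulate (adj v)

  lookup-neighbours-∩ : (s : Subset (Graph.n G)) (v w : V) →
    lookup (neighbours v ∩ s) w ≡ adj v w ∧ lookup s w
  lookup-neighbours-∩ s v w =
    trans (lookup-zipWith _∧_ w (neighbours v) s) (cong (_∧ lookup s w) (lookup∘tabulate (adj v) w))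

  clique-twins-of-≡-trace : ∀ {U a b} → IsClique adj U → a ∈ U → b ∈ U →
    neighbours a ∩ nbhd adj U ≡ neighbours b ∩ nbhd adj U → TrueTwins G a b
  clique-twins-of-≡-trace {U} {a} {b} isClique a∈U b∈U sameTrace =
    trueTwins-intro (isClique a b a∈U b∈U) sameAdj
    where
    N = nbhd adj U
    sameAdj : ∀ w → w ≢ a → w ≢ b → adj a w ≡ adj b w
    sameAdj w w≢a w≢b with w ∈? U | w ∈? N
    ... | yes w∈U | _ = trans (isClique a w a∈U w∈U (w≢a ∘ sym)) (sym (isClique b w b∈U w∈U (w≢b ∘ sym)))
    ... | no w∉U | yes w∈N = begin
      adj a w                      ≡⟨ ∧-identityʳ (adj a w) ⟨
      adj a w ∧ true               ≡⟨ cong (adj a w ∧_) ([]=⇒lookup w∈N) ⟨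
      adj a w ∧ lookup N w         ≡⟨ lookup-neighbours-∩ N a w ⟨
      lookup (neighbours a ∩ N) w  ≡⟨ cong (flip lookup w) sameTrace ⟩
      lookup (neighbours b ∩ N) w  ≡⟨ lookup-neighbours-∩ N b w ⟩
      adj b w ∧ lookup N w         ≡⟨ cong (adj b w ∧_) ([]=⇒lookup w∈N) ⟩
      adj b w ∧ true               ≡⟨ ∧-identityʳ (adj b w) ⟩
      adj b w                      ∎
      where open ≡-Reasoning
    ... | no w∉U | no w∉N = trans (unseen a∈U) (sym (unseen b∈U))
      where
      unseen : ∀ {u} → u ∈ U → adj u w ≡ false
      unseen u∈U = ¬-not (w∉N ∘ ∈-nbhd⁺ w∉U u∈U)

module _ (G : Graph) (Q : TwinQuotient G) where
  open Graph G using (adj)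
  open TwinQuotient Q using (q; surj; twins)

  rep : Fin (TwinQuotient.m Q) → Fin (Graph.n G)
  rep x = proj₁ (surj x)

  q∘rep : ∀ x → q (rep x) ≡ x
  q∘rep x = proj₂ (surj x)

  rep-injective : ∀ {x y} → rep x ≡ rep y → x ≡ y
  rep-injective {x} {y} eq = trans (sym (q∘rep x)) (trans (cong q eq) (q∘rep y))

  rep-twins⇒≡ : ∀ {x y} → TrueTwins G (rep x) (rep y) → x ≡ y
  rep-twins⇒≡ {x} {y} tw = trans (sym (q∘rep x)) (trans (Equivalence.from (twins _ _) tw) (q∘rep y))

  twinClosed-∈ : ∀ {U u v} → TwinClosed G U → q u ≡ q v → v ∈ U → u ∈ U
  twinClosed-∈ closed = closed ∘ Equivalence.to (twins _ _)

  contract : Subset (Graph.n G) → Subset (TwinQuotient.m Q)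
  contract U = tabulate (lookup U ∘ rep)

  ∈-contract⁺ : ∀ {U x} → rep x ∈ U → x ∈ contract U
  ∈-contract⁺ = ∈-tabulate⁺ ∘ []=⇒lookup

  ∈-contract⁻ : ∀ {U x} → x ∈ contract U → rep x ∈ U
  ∈-contract⁻ {U} {x} = lookup⇒[]= (rep x) U ∘ ∈-tabulate⁻

  twinClosed⇒isExpansion : ∀ {U} → TwinClosed G U → IsExpansion G Q U (contract U)
  twinClosed⇒isExpansion closed v = mk⇔
    (∈-contract⁺ ∘ twinClosed-∈ closed (q∘rep (q v)))
    (twinClosed-∈ closed (sym (q∘rep (q v))) ∘ ∈-contract⁻)

  quotAdj-intro : ∀ {x y u v} → x ≢ y → q u ≡ x → q v ≡ y → adj u v ≡ true → quotAdj G Q x y ≡ true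
  quotAdj-intro {u = u} {v} x≢y qu qv uv = cong₂ _∧_ (cong not (⌊≟⌋≡false x≢y))
    (anyFin-true⁺ _ u (anyFin-true⁺ _ v (cong₂ _∧_ (⌊≟⌋≡true⁺ qu) (cong₂ _∧_ (⌊≟⌋≡true⁺ qv) uv))))

  quotAdj-elim : ∀ {x y} → quotAdj G Q x y ≡ true → ∃₂ λ u v → q u ≡ x × q v ≡ y × adj u v ≡ true
  quotAdj-elim {x} {y} xy
    with u , someV ← anyFin-true⁻ _ (∧-conicalʳ _ _ xy)
    with v , quv ← anyFin-true⁻ _ someV
    with qv∧uv ← ∧-conicalʳ ⌊ q u ≟ x ⌋ _ quv =
    u , v , ⌊≟⌋≡true⁻ (∧-conicalˡ _ _ quv) , ⌊≟⌋≡true⁻ (∧-conicalˡ ⌊ q v ≟ y ⌋ _ qv∧uv) ,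
    ∧-conicalʳ ⌊ q v ≟ y ⌋ _ qv∧uv

  contract-isClique : ∀ {U} → IsClique adj U → IsClique (quotAdj G Q) (contract U)
  contract-isClique isClique x y x∈ y∈ x≢y = quotAdj-intro x≢y (q∘rep x) (q∘rep y)
    (isClique (rep x) (rep y) (∈-contract⁻ x∈) (∈-contract⁻ y∈) (x≢y ∘ rep-injective))

  rep-nbhd-contract : ∀ {U y} → TwinClosed G U →
    y ∈ nbhd (quotAdj G Q) (contract U) → rep y ∈ nbhd adj U
  rep-nbhd-contract {U} {y} closed y∈N
    with y∉Ũ , x , x∈Ũ , xy ← ∈-nbhd⁻ y∈N
    with u , v , qu≡x , qv≡y , uv ← quotAdj-elim xy = ∈-nbhd⁺ ry∉U u∈U (begin
      adj u (rep y) ≡⟨ Graph.sym G u (rep y) ⟩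
      adj (rep y) u ≡⟨ twins-adj G rep-y≈v (∈∧∉⇒≢ u∈U ry∉U) (∈∧∉⇒≢ u∈U v∉U) ⟩
      adj v u       ≡⟨ Graph.sym G v u ⟩
      adj u v       ≡⟨ uv ⟩
      true          ∎)
    where
    open ≡-Reasoning
    ry∉U : rep y ∉ U
    ry∉U = y∉Ũ ∘ ∈-contract⁺
    u∈U : u ∈ U
    u∈U = twinClosed-∈ closed (trans qu≡x (sym (q∘rep x))) (∈-contract⁻ x∈Ũ)
    rep-y≈v : TrueTwins G (rep y) v
    rep-y≈v = Equivalence.to (twins _ _) (trans (q∘rep y) (sym qv≡y))
    v∉U : v ∉ U
    v∉U = ry∉U ∘ closed rep-y≈v

  ∣nbhd-contract∣≤∣nbhd∣ : ∀ {U} → TwinClosed G U →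
    ∣ nbhd (quotAdj G Q) (contract U) ∣ ≤ ∣ nbhd adj U ∣
  ∣nbhd-contract∣≤∣nbhd∣ closed =
    injectiveOn⇒∣p∣≤∣q∣ rep (rep-nbhd-contract closed) (λ _ _ → rep-injective)

  ∣contract∣≤2^∣nbhd∣ : ∀ {U} → IsClique adj U → ∣ contract U ∣ ≤ 2 ^ ∣ nbhd adj U ∣
  ∣contract∣≤2^∣nbhd∣ {U} isClique =
    injectiveOn⇒∣p∣≤2^∣s∣ (λ x → neighbours G (rep x) ∩ nbhd adj U) (λ _ → p∩q⊆q _ _)
      (λ x∈ y∈ → rep-twins⇒≡ ∘ clique-twins-of-≡-trace G isClique (∈-contract⁻ x∈) (∈-contract⁻ y∈))

mainTheorem13 : (G : Graph) (Q : TwinQuotient G) (t : ℕ) → 1 ≤ t →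
    (U : Subset (Graph.n G)) → IsMaxSecludedClique (Graph.adj G) t U →
    Σ (Subset (TwinQuotient.m Q)) (λ Ũ →
      IsExpansion G Q U Ũ ×
      IsClique (quotAdj G Q) Ũ × Secluded (quotAdj G Q) t Ũ ×
      ∣ Ũ ∣ ≤ 2 ^ t)
mainTheorem13 G Q t _ U maxClique@(isClique , secluded , _) =
  contract G Q U ,
  twinClosed⇒isExpansion G Q closed ,
  contract-isClique G Q isClique ,
  ≤-trans (∣nbhd-contract∣≤∣nbhd∣ G Q closed) secluded ,
  ≤-trans (∣contract∣≤2^∣nbhd∣ G Q isClique) (^-monoʳ-≤ 2 secluded)
  where
  closed : TwinClosed G U
  closed = maxSecludedClique-twinClosed G maxClique
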